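{- Let $d$ be a positive integer and $V \leq H_d$ such that $S = (H_d/V,a,b,c)$ is a degree-$d$-surface. Then the geodesic dual of $S$ is isomorphic to $(H_d/V^{\#},a,b,c)$. In particular, $S$ is geodesic self-dual if and only if $V^{\#}$ is conjugate to $V$ in $H_d$.
   Context: $H_d = \langle a,b,c \mid a^2,b^2,c^2,(ab)^3,(ac)^2,(bc)^d,(bac)^d\rangle$. $\#: H_d\to H_d$ is the automorphism determined by $a\mapsto a$, $b\mapsto b$, $c\mapsto ac$, and $V^{\#}=\{\#(g):g\in V\}$. A surface is a quadruple $(\mathcal{F},\alpha,\beta,\gamma)$ with $\mathcal{F}$ a set and $\alpha,\beta,\gamma$ permutations of $\mathcal{F}$ such that: $\alpha,\beta,\gamma$ are fixed-point-free involutions; $\langle\alpha,\beta,\gamma\rangle$ is transitive on $\mathcal{F}$; $\alpha\beta$ consists only of 3-cycles; $\alpha\gamma$ consists only of 2-cycles. It is a degree-$d$-surface if also $\beta\gamma$ consists only of $d$-cycles. The geodesic dual of $(\mathcal{F},\alpha,\beta,\gamma)$ is $(\mathcal{F},\alpha,\beta,\alpha\gamma)$. An isomorphism $(\mathcal{F},\alpha,\beta,\gamma)\to(\mathcal{G},\rho,\sigma,\tau)$ is a bijection $\phi$ with $\phi^{ -1}\alpha\phi=\rho$, $\phi^{ -1}\beta\phi=\sigma$, $\phi^{ -1}\gamma\phi=\tau$; a surface is geodesic self-dual if isomorphic to its geodesic dual. For $V\le H_d$, $(H_d/V,a,b,c)$ has as flags the left cosets $hV$ and as permutations the left multiplications by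 $a,b,c$. -}

module Defs where

open import Data.Nat using (ℕ; zero; suc; _<_)
open import Data.List using (List; []; _∷_; _++_; reverse; concat; replicate; concatMap)
open import Data.List.Membership.Propositional using (_∈_)
open import Data.Product using (Σ; ∃; _×_; _,_)
open import Function using (_∘_; id)
open import Relation.Nullary using (¬_)
open import Relation.Binary using (IsEquivalence)

-- The group H_d = < a,b,c | a²,b²,c²,(ab)³,(ac)²,(bc)^d,(bac)^d >
-- Elements are represented by words over the generators {a,b,c}
-- (each generator is an involution, so no inverse letters are needed).
-- Multiplication is concatenation, the identity is [], the inverse of
-- a word is its reverse.  Equality in H_d is the congruence generated
-- by the relators.

data Gen : Set where
  a b c : Gen

Word : Set
Word = List Gen

_^w_ : Word → ℕ → Word
w ^w n = concat (replicate n w)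

relators : ℕ → List Word
relators d =
  (a ∷ a ∷ []) ∷ (b ∷ b ∷ []) ∷ (c ∷ c ∷ []) ∷
  ((a ∷ b ∷ []) ^w 3) ∷ ((a ∷ c ∷ []) ^w 2) ∷
  ((b ∷ c ∷ []) ^w d) ∷ ((b ∷ a ∷ c ∷ []) ^w d) ∷ []

data _≈[_]_ : Word → ℕ → Word → Set where
  ≈-refl  : ∀ {d w} → w ≈[ d ] w
  ≈-sym   : ∀ {d u v} → u ≈[ d ] v → v ≈[ d ] u
  ≈-trans : ∀ {d u v w} → u ≈[ d ] v → v ≈[ d ] w → u ≈[ d ] w
  ≈-rel   : ∀ {d r} u v → r ∈ relators d → (u ++ r ++ v) ≈[ d ] (u ++ v)

inv : Word → Word
inv = reverse

record Subgroup (d : ℕ) : Set₁ where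
  field
    mem     : Word → Set
    respect : ∀ {u v} → u ≈[ d ] v → mem u → mem v
    one     : mem []
    mul     : ∀ {u v} → mem u → mem v → mem (u ++ v)
    invC    : ∀ {u} → mem u → mem (inv u)

sharpGen : Gen → Word
sharpGen a = a ∷ []
sharpGen b = b ∷ []
sharpGen c = a ∷ c ∷ []

sharp : Word → Word
sharp = concatMap sharpGen

Sharp : (d : ℕ) → Subgroup d → Word → Set
Sharp d V h = Σ Word λ g → Subgroup.mem V g × (h ≈[ d ] sharp g)

Conjugate : (d : ℕ) → (Word → Set) → Subgroup d → Set
Conjugate d U V = Σ Word λ g → ∀ h →
  (U h → Subgroup.mem V (inv g ++ h ++ g)) × (Subgroup.mem V (inv g ++ h ++ g) → U h)

-- Surfaces.  A "flag structure" is a carrier with an equality relation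
-- (a setoid, so that coset spaces can be represented) and three maps.

record FlagStructure : Set₁ where
  field
    Flag  : Set
    _≃_   : Flag → Flag → Set
    α β γ : Flag → Flag

iter : {A : Set} → (A → A) → ℕ → A → A
iter f zero    = id
iter f (suc n) = f ∘ iter f n

module _ (S : FlagStructure) where
  open FlagStructure S

  -- composition of permutations, read left-to-right: x^(πσ) = σ(π(x))
  _⊙_ : (Flag → Flag) → (Flag → Flag) → Flag → Flag
  (π ⊙ σ) x = σ (π x)

  act : Word → Flag → Flag
  act []       x = x
  act (a ∷ w) x = act w (α x)
  act (b ∷ w) x = act w (β x)
  act (c ∷ w) x = act w (γ x)

  Respects : (Flag → Flag) → Set
  Respects f = ∀ {x y} → x ≃ y → f x ≃ f y

  FPFInvolution : (Flag → Flag) → Set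
  FPFInvolution f = Respects f × (∀ x → f (f x) ≃ x) × (∀ x → ¬ (f x ≃ x))

  OnlyCycles : ℕ → (Flag → Flag) → Set
  OnlyCycles k f = ∀ x → (iter f k x ≃ x) × (∀ j → 0 < j → j < k → ¬ (iter f j x ≃ x))

  IsSurface : Set
  IsSurface =
    IsEquivalence _≃_ ×
    FPFInvolution α × FPFInvolution β × FPFInvolution γ ×
    (∀ x y → ∃ λ w → act w x ≃ y) ×
    OnlyCycles 3 (α ⊙ β) ×
    OnlyCycles 2 (α ⊙ γ)

  IsDegreeSurface : ℕ → Set
  IsDegreeSurface d = IsSurface × OnlyCycles d (β ⊙ γ)

geodesicDual : FlagStructure → FlagStructure
geodesicDual S = record
  { Flag = Flag ; _≃_ = _≃_ ; α = α ; β = β ; γ = _⊙_ S α γ }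
  where open FlagStructure S

-- isomorphism: bijection φ with φ⁻¹αφ = ρ, φ⁻¹βφ = σ, φ⁻¹γφ = τ
-- (i.e. φ(α x) = ρ(φ x) etc.)
record Iso (S T : FlagStructure) : Set where
  module S = FlagStructure S
  module T = FlagStructure T
  field
    φ        : S.Flag → T.Flag
    φ-resp   : ∀ {x y} → x S.≃ y → φ x T.≃ φ y
    φ-inj    : ∀ {x y} → φ x T.≃ φ y → x S.≃ y
    φ-surj   : ∀ y → ∃ λ x → φ x T.≃ y
    φ-α      : ∀ x → φ (S.α x) T.≃ T.α (φ x)
    φ-β      : ∀ x → φ (S.β x) T.≃ T.β (φ x)
    φ-γ      : ∀ x → φ (S.γ x) T.≃ T.γ (φ x)

GeodesicSelfDual : FlagStructure → Set
GeodesicSelfDual S = Iso S (geodesicDual S)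

-- (H_d / U, a, b, c): left cosets hU, hU = h'U iff h⁻¹h' ∈ U,
-- permutations are left multiplication by a, b, c.
cosetSurface : (Word → Set) → FlagStructure
cosetSurface U = record
  { Flag = Word
  ; _≃_  = λ h h' → U (inv h ++ h')
  ; α    = a ∷_
  ; β    = b ∷_
  ; γ    = c ∷_
  }

module Submission where

-- Proof outline.
--  * Presentation: basic calculus in H_d on words (concatenation is a
--    congruence, inverses, a and c commute), and the fact that a map on the
--    generators killing every relator induces an endomorphism of H_d.
--  * The automorphism #: it kills the relators and is an involution; hence
--    V^# is again a subgroup, and  h ∈ V^#  iff  #h ∈ V.
--  * Cosets: "xV = yV" is an equivalence relation invariant under left
--    multiplication.
--  * Coset surfaces of H_d are isomorphic iff the subgroups are conjugate:
--    an isomorphism commutes with left multiplication by generators, so it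
--    is right multiplication by k = φ(1); conversely right multiplication by
--    g is an isomorphism when U = g V g⁻¹.
--  * # itself maps the geodesic dual of H_d/V isomorphically onto H_d/V^#
--    (and H_d/V^# onto the dual), since #(c) = ac is the dual's γ.
--  Self-duality then amounts to an isomorphism H_d/V ≅ H_d/V^#, i.e. to
--  conjugacy.

open import Defs
open import Level using (0ℓ)
open import Data.Nat using (ℕ; NonZero; zero; suc)
open import Data.Product using (_×_; _,_; ∃; proj₁; proj₂)
open import Data.List using ([]; _∷_; _++_; concatMap)
open import Data.List.Properties
  using (++-assoc; ++-identityʳ; reverse-++; unfold-reverse; reverse-involutive; concatMap-++)
open import Data.List.Relation.Unary.Any using (here; there)
open import Data.List.Membership.Propositional using (_∈_)
open import Function.Bundles using (_⇔_; mk⇔; Equivalence)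
open import Relation.Binary.Bundles using (Setoid)
open import Relation.Binary.Definitions using (Transitive)
open import Relation.Binary.PropositionalEquality
  using (_≡_; refl; sym; trans; cong; subst; subst₂; module ≡-Reasoning)
import Relation.Binary.Reasoning.Setoid as SetoidReasoning

-- Composition of isomorphisms of flag structures; only transitivity of the
-- target's flag equality is needed.
Iso-trans : {S R T : FlagStructure} → Transitive (FlagStructure._≃_ T) →
            Iso S R → Iso R T → Iso S T
Iso-trans {T = T} ≃-trans I J = record
  { φ      = λ x → J.φ (I.φ x)
  ; φ-resp = λ e → J.φ-resp (I.φ-resp e)
  ; φ-inj  = λ e → I.φ-inj (J.φ-inj e)
  ; φ-surj = surj
  ; φ-α    = λ x → ≃-trans (J.φ-resp (I.φ-α x)) (J.φ-α (I.φ x))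
  ; φ-β    = λ x → ≃-trans (J.φ-resp (I.φ-β x)) (J.φ-β (I.φ x))
  ; φ-γ    = λ x → ≃-trans (J.φ-resp (I.φ-γ x)) (J.φ-γ (I.φ x))
  }
  where
  module I = Iso I
  module J = Iso J
  surj : ∀ z → ∃ λ x → FlagStructure._≃_ T (J.φ (I.φ x)) z
  surj z with J.φ-surj z
  ... | y , Jy≃z with I.φ-surj y
  ...   | x , Ix≃y = x , ≃-trans (J.φ-resp Ix≃y) Jy≃z

suffix-conjugate : ∀ g x y → inv (x ++ g) ++ (y ++ g) ≡ inv g ++ (inv x ++ y) ++ g
suffix-conjugate g x y = begin
  inv (x ++ g) ++ y ++ g       ≡⟨ cong (_++ y ++ g) (reverse-++ x g) ⟩
  (inv g ++ inv x) ++ y ++ g   ≡⟨ ++-assoc (inv g) (inv x) (y ++ g) ⟩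
  inv g ++ inv x ++ y ++ g     ≡⟨ cong (inv g ++_) (++-assoc (inv x) y g) ⟨
  inv g ++ (inv x ++ y) ++ g   ∎
  where open ≡-Reasoning

module Presentation (d : ℕ) where

  infix 4 _∼_
  _∼_ : Word → Word → Set
  u ∼ v = u ≈[ d ] v

  wordSetoid : Setoid 0ℓ 0ℓ
  wordSetoid = record
    { Carrier = Word ; _≈_ = _∼_
    ; isEquivalence = record { refl = ≈-refl ; sym = ≈-sym ; trans = ≈-trans } }

  open SetoidReasoning wordSetoid

  ≡⇒∼ : ∀ {u v} → u ≡ v → u ∼ v
  ≡⇒∼ refl = ≈-refl

  ++-congˡ : ∀ p {u v} → u ∼ v → p ++ u ∼ p ++ v
  ++-congˡ p ≈-refl        = ≈-refl
  ++-congˡ p (≈-sym e)     = ≈-sym (++-congˡ p e)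
  ++-congˡ p (≈-trans e f) = ≈-trans (++-congˡ p e) (++-congˡ p f)
  ++-congˡ p (≈-rel {r = r} u v m) =
    subst₂ _∼_ (++-assoc p u (r ++ v)) (++-assoc p u v) (≈-rel (p ++ u) v m)

  ++-congʳ : ∀ q {u v} → u ∼ v → u ++ q ∼ v ++ q
  ++-congʳ q ≈-refl        = ≈-refl
  ++-congʳ q (≈-sym e)     = ≈-sym (++-congʳ q e)
  ++-congʳ q (≈-trans e f) = ≈-trans (++-congʳ q e) (++-congʳ q f)
  ++-congʳ q (≈-rel {r = r} u v m) =
    subst₂ _∼_ (sym (trans (++-assoc u (r ++ v) q) (cong (u ++_) (++-assoc r v q))))
               (sym (++-assoc u v q)) (≈-rel u (v ++ q) m)

  ++-cong : ∀ {u u' v v'} → u ∼ u' → v ∼ v' → u ++ v ∼ u' ++ v'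
  ++-cong {u' = u'} {v = v} e f = ≈-trans (++-congʳ v e) (++-congˡ u' f)

  relator∼[] : ∀ {r} → r ∈ relators d → r ∼ []
  relator∼[] {r} m = subst (_∼ []) (++-identityʳ r) (≈-rel [] [] m)

  cancel : ∀ x w → x ∷ x ∷ w ∼ w
  cancel a w = ≈-rel [] w (here refl)
  cancel b w = ≈-rel [] w (there (here refl))
  cancel c w = ≈-rel [] w (there (there (here refl)))

  ac∼ca : ∀ w → a ∷ c ∷ w ∼ c ∷ a ∷ w
  ac∼ca w = begin
    a ∷ c ∷ w                 ≈⟨ cancel c _ ⟨
    c ∷ c ∷ a ∷ c ∷ w         ≈⟨ ++-congˡ (c ∷ []) (cancel a _) ⟨
    c ∷ a ∷ a ∷ c ∷ a ∷ c ∷ w ≈⟨ ≈-rel (c ∷ a ∷ []) w (there (there (there (there (here refl))))) ⟩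
    c ∷ a ∷ w                 ∎

  inv-left : ∀ w → inv w ++ w ∼ []
  inv-left []      = ≈-refl
  inv-left (x ∷ w) = begin
    inv (x ∷ w) ++ x ∷ w       ≡⟨ cong (_++ x ∷ w) (unfold-reverse x w) ⟩
    (inv w ++ x ∷ []) ++ x ∷ w ≡⟨ ++-assoc (inv w) (x ∷ []) (x ∷ w) ⟩
    inv w ++ x ∷ x ∷ w         ≈⟨ ++-congˡ (inv w) (cancel x w) ⟩
    inv w ++ w                 ≈⟨ inv-left w ⟩
    []                         ∎

  inv-right : ∀ w → w ++ inv w ∼ []
  inv-right w = subst (λ z → z ++ inv w ∼ []) (reverse-involutive w) (inv-left (inv w))

  inverse-unique : ∀ {u v} → u ++ v ∼ [] → u ∼ inv v
  inverse-unique {u} {v} uv∼[] = begin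
    u                ≡⟨ ++-identityʳ u ⟨
    u ++ []          ≈⟨ ++-congˡ u (inv-right v) ⟨
    u ++ v ++ inv v  ≡⟨ ++-assoc u v (inv v) ⟨
    (u ++ v) ++ inv v ≈⟨ ++-congʳ (inv v) uv∼[] ⟩
    inv v            ∎

  inv-cong : ∀ {u v} → u ∼ v → inv u ∼ inv v
  inv-cong {u} e = inverse-unique (≈-trans (++-congˡ (inv u) (≈-sym e)) (inv-left u))

  prefix-cancel : ∀ p x y → inv (p ++ x) ++ (p ++ y) ∼ inv x ++ y
  prefix-cancel p x y = begin
    inv (p ++ x) ++ p ++ y         ≡⟨ cong (_++ p ++ y) (reverse-++ p x) ⟩
    (inv x ++ inv p) ++ p ++ y     ≡⟨ ++-assoc (inv x) (inv p) (p ++ y) ⟩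
    inv x ++ inv p ++ p ++ y       ≡⟨ cong (inv x ++_) (++-assoc (inv p) p y) ⟨
    inv x ++ (inv p ++ p) ++ y     ≈⟨ ++-congˡ (inv x) (++-congʳ y (inv-left p)) ⟩
    inv x ++ y                     ∎

  right-cancel : ∀ g y → (y ++ inv g) ++ g ∼ y
  right-cancel g y = begin
    (y ++ inv g) ++ g  ≡⟨ ++-assoc y (inv g) g ⟩
    y ++ inv g ++ g    ≈⟨ ++-congˡ y (inv-left g) ⟩
    y ++ []            ≡⟨ ++-identityʳ y ⟩
    y                  ∎

  conjugate-cancel : ∀ g h → inv g ++ (g ++ h ++ inv g) ++ g ∼ h
  conjugate-cancel g h = begin
    inv g ++ (g ++ h ++ inv g) ++ g  ≡⟨ cong (λ z → inv g ++ z ++ g) (++-assoc g h (inv g)) ⟨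
    inv g ++ ((g ++ h) ++ inv g) ++ g ≈⟨ ++-congˡ (inv g) (right-cancel g (g ++ h)) ⟩
    inv g ++ g ++ h                  ≡⟨ ++-assoc (inv g) g h ⟨
    (inv g ++ g) ++ h                ≈⟨ ++-congʳ h (inv-left g) ⟩
    h                                ∎

  KillsRelators : (Gen → Word) → Set
  KillsRelators f = ∀ {r} → r ∈ relators d → concatMap f r ∼ []

  hom-cong : ∀ {f} → KillsRelators f → ∀ {u v} → u ∼ v → concatMap f u ∼ concatMap f v
  hom-cong kill ≈-refl        = ≈-refl
  hom-cong kill (≈-sym e)     = ≈-sym (hom-cong kill e)
  hom-cong kill (≈-trans e f) = ≈-trans (hom-cong kill e) (hom-cong kill f)
  hom-cong {f} kill (≈-rel {r = r} u v m) = begin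
    concatMap f (u ++ r ++ v)                   ≡⟨ concatMap-++ f u (r ++ v) ⟩
    concatMap f u ++ concatMap f (r ++ v)       ≡⟨ cong (concatMap f u ++_) (concatMap-++ f r v) ⟩
    concatMap f u ++ concatMap f r ++ concatMap f v
      ≈⟨ ++-congˡ (concatMap f u) (++-congʳ (concatMap f v) (kill m)) ⟩
    concatMap f u ++ concatMap f v              ≡⟨ concatMap-++ f u v ⟨
    concatMap f (u ++ v)                        ∎

  hom-inv : ∀ {f} → KillsRelators f → ∀ w → concatMap f (inv w) ∼ inv (concatMap f w)
  hom-inv {f} kill w = inverse-unique (begin
    concatMap f (inv w) ++ concatMap f w ≡⟨ concatMap-++ f (inv w) w ⟨
    concatMap f (inv w ++ w)             ≈⟨ hom-cong kill (inv-left w) ⟩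
    []                                   ∎)

  concatMap-pow : ∀ f w n → concatMap f (w ^w n) ≡ concatMap f w ^w n
  concatMap-pow f w zero    = refl
  concatMap-pow f w (suc n) =
    trans (concatMap-++ f w (w ^w n)) (cong (concatMap f w ++_) (concatMap-pow f w n))

  pow-cong : ∀ {u v} n → u ∼ v → u ^w n ∼ v ^w n
  pow-cong zero    e = ≈-refl
  pow-cong (suc n) e = ++-cong e (pow-cong n e)

  -- # is an endomorphism: it maps c², (bc)^d, (bac)^d to (ac)², (bac)^d,
  -- (bc)^d up to cancelling a², and fixes the remaining relators.
  sharp-kills-relators : KillsRelators sharpGen
  sharp-kills-relators (here refl)                = cancel a []
  sharp-kills-relators (there (here refl))        = cancel b []
  sharp-kills-relators (there (there (here refl))) =
    relator∼[] (there (there (there (there (here refl)))))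
  sharp-kills-relators (there (there (there (here refl)))) =
    relator∼[] (there (there (there (here refl))))
  sharp-kills-relators (there (there (there (there (here refl))))) =
    ≈-trans (cancel a _) (≈-trans (++-congˡ (c ∷ []) (cancel a _)) (cancel c []))
  sharp-kills-relators (there (there (there (there (there (here refl)))))) = begin
    sharp ((b ∷ c ∷ []) ^w d)  ≡⟨ concatMap-pow sharpGen (b ∷ c ∷ []) d ⟩
    (b ∷ a ∷ c ∷ []) ^w d      ≈⟨ relator∼[] (there (there (there (there (there (there (here refl))))))) ⟩
    []                         ∎
  sharp-kills-relators (there (there (there (there (there (there (here refl))))))) = begin
    sharp ((b ∷ a ∷ c ∷ []) ^w d) ≡⟨ concatMap-pow sharpGen (b ∷ a ∷ c ∷ []) d ⟩
    (b ∷ a ∷ a ∷ c ∷ []) ^w d     ≈⟨ pow-cong d (++-congˡ (b ∷ []) (cancel a (c ∷ []))) ⟩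
    (b ∷ c ∷ []) ^w d             ≈⟨ relator∼[] (there (there (there (there (there (here refl)))))) ⟩
    []                            ∎
  sharp-kills-relators (there (there (there (there (there (there (there ())))))))

  sharp-cong : ∀ {u v} → u ∼ v → sharp u ∼ sharp v
  sharp-cong = hom-cong sharp-kills-relators

  -- # is an involution, hence an automorphism.
  sharp-involutive : ∀ w → sharp (sharp w) ∼ w
  sharp-involutive []      = ≈-refl
  sharp-involutive (a ∷ w) = ++-congˡ (a ∷ []) (sharp-involutive w)
  sharp-involutive (b ∷ w) = ++-congˡ (b ∷ []) (sharp-involutive w)
  sharp-involutive (c ∷ w) = ≈-trans (cancel a _) (++-congˡ (c ∷ []) (sharp-involutive w))

  sharp-difference : ∀ x y → sharp (inv x ++ y) ∼ inv (sharp x) ++ sharp y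
  sharp-difference x y = begin
    sharp (inv x ++ y)          ≡⟨ concatMap-++ sharpGen (inv x) y ⟩
    sharp (inv x) ++ sharp y    ≈⟨ ++-congʳ (sharp y) (hom-inv sharp-kills-relators x) ⟩
    inv (sharp x) ++ sharp y    ∎

  module Cosets (V : Subgroup d) where
    open Subgroup V

    infix 4 _≐_
    _≐_ : Word → Word → Set
    x ≐ y = mem (inv x ++ y)

    ≐-refl : ∀ x → x ≐ x
    ≐-refl x = respect (≈-sym (inv-left x)) one

    ≐-reflexive : ∀ {x y} → x ∼ y → x ≐ y
    ≐-reflexive {x} e = respect (≈-sym (≈-trans (++-congˡ (inv x) (≈-sym e)) (inv-left x))) one

    ≐-sym : ∀ {x y} → x ≐ y → y ≐ x
    ≐-sym {x} {y} m =
      respect (≡⇒∼ (trans (reverse-++ (inv x) y) (cong (inv y ++_) (reverse-involutive x)))) (invC m)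

    ≐-trans : Transitive _≐_
    ≐-trans {x} {y} {z} m n = respect combine (mul m n)
      where
      combine : (inv x ++ y) ++ inv y ++ z ∼ inv x ++ z
      combine = begin
        (inv x ++ y) ++ inv y ++ z   ≡⟨ ++-assoc (inv x) y (inv y ++ z) ⟩
        inv x ++ y ++ inv y ++ z     ≡⟨ cong (inv x ++_) (++-assoc y (inv y) z) ⟨
        inv x ++ (y ++ inv y) ++ z   ≈⟨ ++-congˡ (inv x) (++-congʳ z (inv-right y)) ⟩
        inv x ++ z                   ∎

    ≐-prefix : ∀ p {x y} → x ≐ y → p ++ x ≐ p ++ y
    ≐-prefix p {x} {y} = respect (≈-sym (prefix-cancel p x y))

  module SharpSubgroup (V : Subgroup d) where
    open Subgroup V

    Sharp⇒ : ∀ {h} → Sharp d V h → mem (sharp h)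
    Sharp⇒ (g , g∈V , h∼#g) = respect (≈-sym (≈-trans (sharp-cong h∼#g) (sharp-involutive g))) g∈V

    Sharp⇐ : ∀ {h} → mem (sharp h) → Sharp d V h
    Sharp⇐ {h} #h∈V = sharp h , #h∈V , ≈-sym (sharp-involutive h)

    sharpSubgroup : Subgroup d
    sharpSubgroup = record
      { mem     = Sharp d V
      ; respect = λ e m → Sharp⇐ (respect (sharp-cong e) (Sharp⇒ m))
      ; one     = [] , one , ≈-refl
      ; mul     = λ { (g , g∈V , e) (g' , g'∈V , e') →
                    g ++ g' , mul g∈V g'∈V
                    , ≈-trans (++-cong e e') (≡⇒∼ (sym (concatMap-++ sharpGen g g'))) }
      ; invC    = λ { (g , g∈V , e) →
                    inv g , invC g∈V
                    , ≈-trans (inv-cong e) (≈-sym (hom-inv sharp-kills-relators g)) }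
      }

  conjugate-sym : (U V : Subgroup d) → Conjugate d (Subgroup.mem U) V → Conjugate d (Subgroup.mem V) U
  conjugate-sym U V (g , U↔V) = inv g , λ h → to h , from h
    where
    module V = Subgroup V
    g⁻¹⁻¹≡g : inv (inv g) ≡ g
    g⁻¹⁻¹≡g = reverse-involutive g
    to : ∀ h → V.mem h → Subgroup.mem U (inv (inv g) ++ h ++ inv g)
    to h h∈V = subst (λ k → Subgroup.mem U (k ++ h ++ inv g)) (sym g⁻¹⁻¹≡g)
                 (proj₂ (U↔V (g ++ h ++ inv g)) (V.respect (≈-sym (conjugate-cancel g h)) h∈V))
    from : ∀ h → Subgroup.mem U (inv (inv g) ++ h ++ inv g) → V.mem h
    from h m = V.respect (conjugate-cancel g h)
                 (proj₁ (U↔V (g ++ h ++ inv g)) (subst (λ k → Subgroup.mem U (k ++ h ++ inv g)) g⁻¹⁻¹≡g m))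

  coset-iso⇔conjugate : (U : Word → Set) (V : Subgroup d) →
    Iso (cosetSurface U) (cosetSurface (Subgroup.mem V)) ⇔ Conjugate d U V
  coset-iso⇔conjugate U V = mk⇔ iso⇒conjugate conjugate⇒iso
    where
    open Subgroup V
    open Cosets V

    -- An isomorphism commutes with left multiplication by generators, so it
    -- is right multiplication by k = φ(1); then U = kVk⁻¹.
    iso⇒conjugate : Iso (cosetSurface U) (cosetSurface mem) → Conjugate d U V
    iso⇒conjugate I = k , λ h → to h , from h
      where
      open Iso I
      k : Word
      k = φ []
      φ-generator : ∀ x w → φ (x ∷ w) ≐ x ∷ φ w
      φ-generator a = φ-α
      φ-generator b = φ-β
      φ-generator c = φ-γ
      φ-translates : ∀ w → φ w ≐ w ++ k
      φ-translates []      = ≐-refl k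
      φ-translates (x ∷ w) = ≐-trans {φ (x ∷ w)} {x ∷ φ w} (φ-generator x w)
                                     (≐-prefix (x ∷ []) {φ w} (φ-translates w))
      to : ∀ h → U h → k ≐ h ++ k
      to h h∈U = ≐-trans {k} {φ h} (φ-resp {[]} {h} h∈U) (φ-translates h)
      from : ∀ h → k ≐ h ++ k → U h
      from h m = φ-inj {[]} {h} (≐-trans {k} {h ++ k} m (≐-sym {φ h} (φ-translates h)))

    conjugate⇒iso : Conjugate d U V → Iso (cosetSurface U) (cosetSurface mem)
    conjugate⇒iso (g , U↔V) = record
      { φ      = _++ g
      ; φ-resp = λ {x} {y} m → respect (≡⇒∼ (sym (suffix-conjugate g x y))) (proj₁ (U↔V (inv x ++ y)) m)
      ; φ-inj  = λ {x} {y} m → proj₂ (U↔V (inv x ++ y)) (respect (≡⇒∼ (suffix-conjugate g x y)) m)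
      ; φ-surj = λ y → y ++ inv g , ≐-reflexive (right-cancel g y)
      ; φ-α    = λ x → ≐-refl (a ∷ x ++ g)
      ; φ-β    = λ x → ≐-refl (b ∷ x ++ g)
      ; φ-γ    = λ x → ≐-refl (c ∷ x ++ g)
      }

  -- # maps the geodesic dual of H_d/V onto H_d/V^# and H_d/V^# onto the
  -- geodesic dual of H_d/V: it fixes a, b and turns c into the dual's γ = ac.
  module SharpIsos (V : Subgroup d) where
    open Subgroup V
    open SharpSubgroup V
    module V# = Cosets sharpSubgroup
    open Cosets V

    dual→sharp : Iso (geodesicDual (cosetSurface mem)) (cosetSurface (Sharp d V))
    dual→sharp = record
      { φ      = sharp
      ; φ-resp = λ {x} {y} m → inv x ++ y , m , ≈-sym (sharp-difference x y)
      ; φ-inj  = λ {x} {y} m → respect (reflect x y) (Sharp⇒ {inv (sharp x) ++ sharp y} m)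
      ; φ-surj = λ y → sharp y , V#.≐-reflexive (sharp-involutive y)
      ; φ-α    = λ x → V#.≐-refl (a ∷ sharp x)
      ; φ-β    = λ x → V#.≐-refl (b ∷ sharp x)
      ; φ-γ    = λ x → V#.≐-reflexive (≈-trans (ac∼ca (a ∷ sharp x)) (++-congˡ (c ∷ []) (cancel a _)))
      }
      where
      reflect : ∀ x y → sharp (inv (sharp x) ++ sharp y) ∼ inv x ++ y
      reflect x y = ≈-trans (sharp-difference (sharp x) (sharp y))
                            (++-cong (inv-cong (sharp-involutive x)) (sharp-involutive y))

    sharp→dual : Iso (cosetSurface (Sharp d V)) (geodesicDual (cosetSurface mem))
    sharp→dual = record
      { φ      = sharp
      ; φ-resp = λ {x} {y} m → respect (sharp-difference x y) (Sharp⇒ {inv x ++ y} m)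
      ; φ-inj  = λ {x} {y} m → Sharp⇐ {inv x ++ y} (respect (≈-sym (sharp-difference x y)) m)
      ; φ-surj = λ y → sharp y , ≐-reflexive (sharp-involutive y)
      ; φ-α    = λ x → ≐-refl (a ∷ sharp x)
      ; φ-β    = λ x → ≐-refl (b ∷ sharp x)
      ; φ-γ    = λ x → ≐-reflexive (ac∼ca (sharp x))
      }

proposition4p14 : (d : ℕ) → .{{_ : NonZero d}} → (V : Subgroup d) →
    IsDegreeSurface (cosetSurface (Subgroup.mem V)) d →
    Iso (geodesicDual (cosetSurface (Subgroup.mem V))) (cosetSurface (Sharp d V)) ×
    (GeodesicSelfDual (cosetSurface (Subgroup.mem V)) ⇔ Conjugate d (Sharp d V) V)
proposition4p14 d V _ = dual→sharp , mk⇔ selfDual⇒conjugate conjugate⇒selfDual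
  where
  open Presentation d
  open SharpSubgroup V using (sharpSubgroup)
  open SharpIsos V
  V# : Subgroup d
  V# = sharpSubgroup
  open Equivalence (coset-iso⇔conjugate (Subgroup.mem V) V#)
    renaming (to to iso⇒conjugate; from to conjugate⇒iso)

  selfDual⇒conjugate : GeodesicSelfDual (cosetSurface (Subgroup.mem V)) → Conjugate d (Sharp d V) V
  selfDual⇒conjugate I =
    conjugate-sym V V# (iso⇒conjugate (Iso-trans (λ {i j k} → Cosets.≐-trans V# {i} {j} {k}) I dual→sharp))

  conjugate⇒selfDual : Conjugate d (Sharp d V) V → GeodesicSelfDual (cosetSurface (Subgroup.mem V))
  conjugate⇒selfDual conj =
    Iso-trans (λ {i j k} → Cosets.≐-trans V {i} {j} {k}) (conjugate⇒iso (conjugate-sym V# V conj)) sharp→dual
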